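{- Let $k\geq 4$. Let $\bar r=(r_1,\ldots,r_k)$ with $r_i\geq 1$ for all $i$, and let $0\leq\alpha\leq\sum_{i=1}^k r_i-2$. Let $m\in[1,k]$ be the integer with $\sum_{i=1}^{m-1} r_i\leq\alpha<\sum_{i=1}^m r_i$. Let $\mathcal{A}=(a_1,\ldots,a_k)_{\bar r}$ be a finite sequence of integers with $0<a_1<a_2<\cdots<a_k$ and \[|\Sigma_{\alpha}(\bar r,\mathcal{A})|=\sum_{i=1}^k i r_i-\sum_{i=1}^m i r_i+m\left(\sum_{i=1}^m r_i-\alpha\right)+1.\] Then $\mathcal{A}=a_1*[1,k]_{\bar r}$.
   Context: For distinct integers $a_1,\ldots,a_k$ and $\bar r=(r_1,\ldots,r_k)$ with $r_i\geq 1$, $(a_1,\ldots,a_k)_{\bar r}$ denotes the finite sequence consisting of $r_i$ copies of $a_i$ for each $i$. For such a sequence $\mathcal{A}$ and an integer $0\leq\alpha\leq\sum_i r_i$, $\Sigma_{\alpha}(\bar r,\mathcal{A})$ is the set of sums $s(\mathcal{B})$ of all terms of $\mathcal{B}$, over all subsequences $\mathcal{B}$ of $\mathcal{A}$ of length at least $\alpha$ (the empty subsequence has sum $0$). For integers $a\leq b$ with $b-a+1=k$, $[a,b]_{\bar r}$ denotes the sequence $(a,a+1,\ldots,b)_{\bar r}$, and for a positive integer $c$, $c*(a_1,\ldots,a_k)_{\bar r}=(ca_1,\ldots,ca_k)_{\bar r}$. Empty sums are $0$. -}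

module Defs where

open import Data.Nat using (ℕ; zero; suc; _≤_; s≤s; z≤n)
open import Data.Integer using (ℤ; +_; _*_; _≟_)
import Data.Integer as ℤ
open import Data.Fin using (Fin; toℕ)
import Data.Fin
open import Data.List using (List; []; _∷_; _++_; map; concatMap; replicate; length; filter; take; deduplicate)
open import Data.List.Base using (allFin)
open import Data.Nat using (_≤?_)
import Data.Nat as ℕ
open import Data.Nat.ListAction using (sum)

-- The sequence (a_1,...,a_k)_r̄ : r_i copies of a_i, in order i = 1..k
-- (indices are Fin k, i.e. 0-based: a i is a_{i+1}).
seqOf : (k : ℕ) → (Fin k → ℕ) → (Fin k → ℤ) → List ℤ
seqOf k r a = concatMap (λ i → replicate (r i) (a i)) (allFin k)

subseqs : {A : Set} → List A → List (List A)
subseqs [] = [] ∷ []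
subseqs (x ∷ xs) = let s = subseqs xs in map (x ∷_) s ++ s

sumℤ : List ℤ → ℤ
sumℤ [] = + 0
sumℤ (x ∷ xs) = x ℤ.+ sumℤ xs

Sigma : (k : ℕ) → (Fin k → ℕ) → (Fin k → ℤ) → ℕ → List ℤ
Sigma k r a α =
  deduplicate _≟_ (map sumℤ (filter (λ B → α ≤? length B) (subseqs (seqOf k r a))))

cardSigma : (k : ℕ) → (Fin k → ℕ) → (Fin k → ℤ) → ℕ → ℕ
cardSigma k r a α = length (Sigma k r a α)

R : (k : ℕ) → (Fin k → ℕ) → ℕ → ℕ
R k r j = sum (take j (map r (allFin k)))

W : (k : ℕ) → (Fin k → ℕ) → ℕ → ℕ
W k r j = sum (take j (map (λ i → suc (toℕ i) ℕ.* r i) (allFin k)))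

first : {k : ℕ} → 4 ≤ k → Fin k
first {suc k} _ = Data.Fin.zero

module Submission where

-- Write 𝒜 = map A P, where P = (0^{r₁}, 1^{r₂}, …, (k−1)^{r_k}) is the index list and A n = a_{n+1}.
-- A sum of a subsequence of length ≥ α is S − e, where S = s(𝒜) and e, the sum of the deleted
-- terms, is called removable.  Consecutive entries of P differ by 0 or 1, so every index p ≤ q
-- occurs no later than an entry q; hence for every tail q ∷ L of P after at least α entries one may
-- delete L together with one earlier term of index p ≤ q.  These removable sums and 0 form a
-- strictly decreasing chain EC of length Σ_{q ∈ drop α P} (q+1) + 1, which a counting formula
-- identifies with the right-hand side of the hypothesis; so under the hypothesis every removable
-- sum lies on EC.  Two terms with distinct indices can always be deleted (α ≤ N − 2); comparing
-- their sums with the small elements of EC (A_p and A_{k−1} + A_p) yields A₀ + A_j = A_{j+1} for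
-- 1 ≤ j < k−1 and A₁ = 2A₀, hence A_n = (n+1) A₀.

open import Defs
open import Data.Nat using (ℕ; zero; suc; _≤_; _<_; _∸_; z≤n; s≤s; _≟_; _<?_; _≤?_)
import Data.Nat as ℕ
import Data.Nat.Properties as ℕₚ
open import Data.Nat.ListAction using (sum)
import Data.Nat.ListAction.Properties as Sumₚ
open import Data.Integer using (ℤ; 0ℤ) renaming (_<_ to _<ℤ_; _≤_ to _≤ℤ_)
import Data.Integer as ℤ
import Data.Integer.Properties as ℤₚ
open import Algebra.Properties.AbelianGroup ℤₚ.+-0-abelianGroup using (∙-cancelˡ; ∙-cancelʳ; x≈z//y)
open import Data.Fin using (Fin; toℕ; fromℕ<)
import Data.Fin as Fin
open import Data.Fin.Properties using (fromℕ<-toℕ; toℕ-fromℕ<; toℕ<n)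
open import Data.Maybe using (just)
open import Data.Maybe.Relation.Binary.Connected using (Connected; just; just-nothing)
open import Data.List using (List; []; _∷_; _++_; [_]; map; length; replicate; concat; concatMap; take; drop; allFin; downFrom; head)
open import Data.List.Properties using (length-map; length-take; length-drop; take++drop≡id; length-downFrom; map-++; ++-assoc; ++-identityʳ; map-tabulate; map-cong; map-replicate; map-concatMap; concatMap-cong; length-++; length-replicate; length-removeAt′; ∷ʳ-injective)
open import Data.List.Membership.Propositional using (_∈_)
open import Data.List.Membership.Propositional.Properties using (∈-map⁺; ∈-map⁻; ∈-downFrom⁻; ∈-filter⁺; ∈-deduplicate⁺; ∈-++⁺ˡ; ∈-++⁺ʳ; ∈-++⁻)
open import Data.List.Relation.Unary.Any using (here; there; _─_; index)
open import Data.List.Relation.Unary.All using (All; []; _∷_)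
import Data.List.Relation.Unary.All as All
import Data.List.Relation.Unary.All.Properties as AllP
open import Data.List.Relation.Unary.AllPairs using (AllPairs; []; _∷_)
import Data.List.Relation.Unary.AllPairs as AllPairs
import Data.List.Relation.Unary.AllPairs.Properties as AllPairsₚ
open import Data.List.Relation.Unary.Unique.Propositional using (Unique)
import Data.List.Relation.Unary.Unique.Propositional.Properties as Uniqueₚ
open import Data.List.Membership.DecPropositional ℤ._≟_ using (_∈?_)
open import Data.List.Relation.Unary.Linked using (Linked; []; [-]; _∷_)
open import Data.List.Relation.Binary.Sublist.Propositional using (_⊆_; []; _∷_; _∷ʳ_; ⊆-refl; ⊆-trans)
import Data.List.Relation.Binary.Sublist.Propositional.Properties as Sublistₚ
open import Data.List.Relation.Binary.Sublist.Heterogeneous.Properties using (++ʳ)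
open import Data.Empty using (⊥-elim)
open import Data.Sum using (_⊎_; inj₁; inj₂)
open import Data.Product using (∃-syntax; _×_; _,_; proj₁; proj₂)
open import Function using (_∘_; id)
open import Relation.Nullary using (yes; no)
open import Relation.Binary.PropositionalEquality using (_≡_; _≢_; refl; sym; trans; cong; cong₂; subst; subst₂; module ≡-Reasoning)

private
  variable
    T : Set
    x z : T
    xs ys : List T

⊆⇒∈subseqs : xs ⊆ ys → xs ∈ subseqs ys
⊆⇒∈subseqs [] = here refl
⊆⇒∈subseqs {ys = y ∷ ys} (y ∷ʳ τ) = ∈-++⁺ʳ (map (y ∷_) (subseqs ys)) (⊆⇒∈subseqs τ)
⊆⇒∈subseqs (refl ∷ τ) = ∈-++⁺ˡ (∈-map⁺ (_ ∷_) (⊆⇒∈subseqs τ))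

─-⊆ : (x∈ : x ∈ xs) → (xs ─ x∈) ⊆ xs
─-⊆ (here refl) = _ ∷ʳ ⊆-refl
─-⊆ (there x∈) = refl ∷ ─-⊆ x∈

∈-─ : (x∈ : x ∈ xs) → z ∈ xs → z ≢ x → z ∈ (xs ─ x∈)
∈-─ (here refl) (here refl) z≢x = ⊥-elim (z≢x refl)
∈-─ (here refl) (there z∈) _ = z∈
∈-─ (there x∈) (here refl) _ = here refl
∈-─ (there x∈) (there z∈) z≢x = there (∈-─ x∈ z∈ z≢x)

unique⇒length≤ : Unique xs → All (_∈ ys) xs → length xs ≤ length ys
unique⇒length≤ [] [] = z≤n
unique⇒length≤ {ys = ys} (x≢xs ∷ xs!) (x∈ ∷ xs∈) =
  subst (suc _ ≤_) (sym (length-removeAt′ ys (index x∈)))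
    (s≤s (unique⇒length≤ xs! (All.zipWith (λ (z∈ , x≢z) → ∈-─ x∈ z∈ (x≢z ∘ sym)) (xs∈ , x≢xs))))

replicate-suc-∷ʳ : ∀ n (x : T) → replicate (suc n) x ≡ replicate n x ++ [ x ]
replicate-suc-∷ʳ zero x = refl
replicate-suc-∷ʳ (suc n) x = cong (x ∷_) (replicate-suc-∷ʳ n x)

∈-replicate : ∀ n → z ∈ replicate n x → z ≡ x
∈-replicate (suc n) (here z≡x) = z≡x
∈-replicate (suc n) (there z∈) = ∈-replicate n z∈

splitLastTwo : (xs : List T) → 2 ≤ length xs → ∃[ ys ] ∃[ u ] ∃[ v ] xs ≡ ys ++ u ∷ v ∷ []
splitLastTwo (x ∷ []) (s≤s ())
splitLastTwo (u ∷ v ∷ []) _ = [] , u , v , refl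
splitLastTwo (x ∷ y ∷ z ∷ zs) _ with splitLastTwo (y ∷ z ∷ zs) (s≤s (s≤s z≤n))
... | ys , u , v , eq = x ∷ ys , u , v , cong (x ∷_) eq

module IntegerSums where
  open import Data.Integer using (_+_)

  sumℤ-++ : ∀ (xs ys : List ℤ) → sumℤ (xs ++ ys) ≡ sumℤ xs + sumℤ ys
  sumℤ-++ [] ys = sym (ℤₚ.+-identityˡ _)
  sumℤ-++ (x ∷ xs) ys = trans (cong (x +_) (sumℤ-++ xs ys)) (sym (ℤₚ.+-assoc x _ _))

  sumℤ-─ : (f : T → ℤ) (x∈ : x ∈ xs) → sumℤ (map f (xs ─ x∈)) + f x ≡ sumℤ (map f xs)
  sumℤ-─ {xs = y ∷ ys} f (here refl) = ℤₚ.+-comm (sumℤ (map f ys)) (f y)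
  sumℤ-─ {xs = y ∷ ys} f (there x∈) = trans (ℤₚ.+-assoc (f y) _ _) (cong (f y +_) (sumℤ-─ f x∈))

open IntegerSums

Step : ℕ → ℕ → Set
Step x y = x ≤ y × y ≤ suc x

downClosed : ∀ x pre {q rest p} → Linked Step (x ∷ pre ++ q ∷ rest) → x ≤ p → p ≤ q →
             p ∈ x ∷ pre ++ [ q ]
downClosed x pre {p = p} lk x≤p p≤q with p ≟ x
... | yes p≡x = here p≡x
downClosed x [] ((_ , q≤1+x) ∷ _) x≤p p≤q | no p≢x =
  there (here (ℕₚ.≤-antisym p≤q (ℕₚ.≤-trans q≤1+x (ℕₚ.≤∧≢⇒< x≤p (p≢x ∘ sym)))))
downClosed x (y ∷ pre) ((_ , y≤1+x) ∷ lk) x≤p p≤q | no p≢x =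
  there (downClosed y pre lk (ℕₚ.≤-trans y≤1+x (ℕₚ.≤∧≢⇒< x≤p (p≢x ∘ sym))) p≤q)

downClosed₀ : ∀ pre {q rest p} → Linked Step (pre ++ q ∷ rest) → head (pre ++ q ∷ rest) ≡ just 0 →
              p ≤ q → p ∈ pre ++ [ q ]
downClosed₀ [] _ refl z≤n = here refl
downClosed₀ (x ∷ pre) lk refl p≤q = downClosed x pre lk z≤n p≤q

lastStep : ∀ xs {u v} → Linked Step (xs ++ u ∷ v ∷ []) → v ≤ suc u
lastStep [] ((_ , v≤1+u) ∷ _) = v≤1+u
lastStep (x ∷ []) (_ ∷ lk) = lastStep [] lk
lastStep (x ∷ y ∷ xs) (_ ∷ lk) = lastStep (y ∷ xs) lk

module IndexList where
  open import Data.Nat using (_+_; _*_)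

  -- idx o k r = (o^{r₀}, (o+1)^{r₁}, …, (o+k−1)^{r_{k−1}}) lists the index of every term of
  -- (a₁,…,a_k)_r̄, shifted by o so that the recursion over k goes through.
  idx : ℕ → (k : ℕ) → (Fin k → ℕ) → List ℕ
  idx o k r = concatMap (λ i → replicate (r i) (o + toℕ i)) (allFin k)

  Wt : ℕ → (k : ℕ) → (Fin k → ℕ) → ℕ → ℕ
  Wt o k r j = sum (take j (map (λ i → (o + suc (toℕ i)) * r i) (allFin k)))

  -- mass L = Σ_{q ∈ L} (q+1), the size of the chain of removable sums built on a tail L.
  mass : List ℕ → ℕ
  mass L = sum (map suc L)

  map-allFin-suc : ∀ {B : Set} k (g : Fin (suc k) → B) →
                   map g (allFin (suc k)) ≡ g Fin.zero ∷ map (g ∘ Fin.suc) (allFin k)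
  map-allFin-suc k g = cong (g Fin.zero ∷_) (trans (map-tabulate Fin.suc g) (sym (map-tabulate id (g ∘ Fin.suc))))

  idx-suc : ∀ o k r → idx o (suc k) r ≡ replicate (r Fin.zero) o ++ idx (suc o) k (r ∘ Fin.suc)
  idx-suc o k r =
    trans (cong concat (map-allFin-suc k (λ i → replicate (r i) (o + toℕ i))))
      (cong₂ _++_ (cong (replicate (r Fin.zero)) (ℕₚ.+-identityʳ o))
        (concatMap-cong (λ i → cong (replicate (r (Fin.suc i))) (ℕₚ.+-suc o (toℕ i))) (allFin k)))

  R-suc : ∀ k r j → R (suc k) r (suc j) ≡ r Fin.zero + R k (r ∘ Fin.suc) j
  R-suc k r j = cong (sum ∘ take (suc j)) (map-allFin-suc k r)

  Wt-suc : ∀ o k r j → Wt o (suc k) r (suc j) ≡ (o + 1) * r Fin.zero + Wt (suc o) k (r ∘ Fin.suc) j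
  Wt-suc o k r j =
    trans (cong (sum ∘ take (suc j)) (map-allFin-suc k (λ i → (o + suc (toℕ i)) * r i)))
      (cong (λ ws → (o + 1) * r Fin.zero + sum (take j ws))
        (map-cong (λ i → cong (_* r (Fin.suc i)) (ℕₚ.+-suc o (suc (toℕ i)))) (allFin k)))

  Wt-diff : ∀ o k r j → Wt o (suc k) r (suc k) ∸ Wt o (suc k) r (suc j) ≡
                        Wt (suc o) k (r ∘ Fin.suc) k ∸ Wt (suc o) k (r ∘ Fin.suc) j
  Wt-diff o k r j = trans (cong₂ _∸_ (Wt-suc o k r k) (Wt-suc o k r j)) (ℕₚ.[m+n]∸[m+o]≡n∸o ((o + 1) * r Fin.zero) _ _)

  length-idx : ∀ o k r → length (idx o k r) ≡ R k r k
  length-idx o zero r = refl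
  length-idx o (suc k) r = begin
      length (idx o (suc k) r)
    ≡⟨ cong length (idx-suc o k r) ⟩
      length (replicate (r Fin.zero) o ++ idx (suc o) k (r ∘ Fin.suc))
    ≡⟨ length-++ (replicate (r Fin.zero) o) ⟩
      length (replicate (r Fin.zero) o) + length (idx (suc o) k (r ∘ Fin.suc))
    ≡⟨ cong₂ _+_ (length-replicate (r Fin.zero)) (length-idx (suc o) k (r ∘ Fin.suc)) ⟩
      r Fin.zero + R k (r ∘ Fin.suc) k
    ≡⟨ sym (R-suc k r k) ⟩
      R (suc k) r (suc k)
    ∎
    where open ≡-Reasoning

  mass-++ : ∀ xs ys → mass (xs ++ ys) ≡ mass xs + mass ys
  mass-++ xs ys = trans (cong sum (map-++ suc xs ys)) (Sumₚ.sum-++ (map suc xs) (map suc ys))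

  mass-replicate : ∀ n q → mass (replicate n q) ≡ n * suc q
  mass-replicate zero q = refl
  mass-replicate (suc n) q = cong (suc q +_) (mass-replicate n q)

  mass-idx : ∀ o k r → mass (idx o k r) ≡ Wt o k r k
  mass-idx o zero r = refl
  mass-idx o (suc k) r = begin
      mass (idx o (suc k) r)
    ≡⟨ cong mass (idx-suc o k r) ⟩
      mass (replicate (r Fin.zero) o ++ idx (suc o) k (r ∘ Fin.suc))
    ≡⟨ mass-++ (replicate (r Fin.zero) o) _ ⟩
      mass (replicate (r Fin.zero) o) + mass (idx (suc o) k (r ∘ Fin.suc))
    ≡⟨ cong₂ _+_ (trans (mass-replicate (r Fin.zero) o) (ℕₚ.*-comm (r Fin.zero) (suc o)))
                 (mass-idx (suc o) k (r ∘ Fin.suc)) ⟩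
      suc o * r Fin.zero + Wt (suc o) k (r ∘ Fin.suc) k
    ≡⟨ cong (λ c → c * r Fin.zero + Wt (suc o) k (r ∘ Fin.suc) k) (ℕₚ.+-comm 1 o) ⟩
      (o + 1) * r Fin.zero + Wt (suc o) k (r ∘ Fin.suc) k
    ≡⟨ sym (Wt-suc o k r k) ⟩
      Wt o (suc k) r (suc k)
    ∎
    where open ≡-Reasoning

  drop-replicate-++ : ∀ {B : Set} {α n} (b : B) L → α ≤ n → drop α (replicate n b ++ L) ≡ replicate (n ∸ α) b ++ L
  drop-replicate-++ b L z≤n = refl
  drop-replicate-++ b L (s≤s α≤n) = drop-replicate-++ b L α≤n

  drop-replicate-++-+ : ∀ {B : Set} n α (b : B) L → drop (n + α) (replicate n b ++ L) ≡ drop α L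
  drop-replicate-++-+ zero α b L = refl
  drop-replicate-++-+ (suc n) α b L = drop-replicate-++-+ n α b L

  -- The size of the chain built on the tail of the index list after its first α entries,
  -- when Σ_{i<m−1} r_i ≤ α < Σ_{i<m} r_i: this is the right-hand side of the hypothesis on |Σ_α|.
  mass-drop : ∀ m k o r α → 1 ≤ m → m ≤ k → R k r (m ∸ 1) ≤ α → α < R k r m →
              mass (drop α (idx o k r)) ≡ (Wt o k r k ∸ Wt o k r m) + (o + m) * (R k r m ∸ α)
  -- m = 1: the tail is r₀ − α copies of o followed by the rest of the list;
  -- m ≥ 2: the first block lies inside the dropped prefix, so recurse on the remaining indices.
  mass-drop (suc zero) (suc k) o r α _ _ _ α<r₀ = begin
      mass (drop α (idx o (suc k) r))
    ≡⟨ cong (mass ∘ drop α) (idx-suc o k r) ⟩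
      mass (drop α (replicate r₀ o ++ P'))
    ≡⟨ cong mass (drop-replicate-++ o P' α≤r₀) ⟩
      mass (replicate (r₀ ∸ α) o ++ P')
    ≡⟨ mass-++ (replicate (r₀ ∸ α) o) P' ⟩
      mass (replicate (r₀ ∸ α) o) + mass P'
    ≡⟨ cong₂ _+_ (mass-replicate (r₀ ∸ α) o) (mass-idx (suc o) k (r ∘ Fin.suc)) ⟩
      (r₀ ∸ α) * suc o + Wt (suc o) k (r ∘ Fin.suc) k
    ≡⟨ ℕₚ.+-comm ((r₀ ∸ α) * suc o) _ ⟩
      Wt (suc o) k (r ∘ Fin.suc) k + (r₀ ∸ α) * suc o
    ≡⟨ cong₂ _+_ (sym (Wt-diff o k r 0))
                 (trans (ℕₚ.*-comm (r₀ ∸ α) (suc o))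
                   (cong₂ _*_ (ℕₚ.+-comm 1 o) (cong (_∸ α) (sym (ℕₚ.+-identityʳ r₀))))) ⟩
      (Wt o (suc k) r (suc k) ∸ Wt o (suc k) r 1) + (o + 1) * (R (suc k) r 1 ∸ α)
    ∎
    where
      open ≡-Reasoning
      r₀ = r Fin.zero
      P' = idx (suc o) k (r ∘ Fin.suc)
      α≤r₀ : α ≤ r₀
      α≤r₀ = ℕₚ.<⇒≤ (subst (α <_) (ℕₚ.+-identityʳ r₀) α<r₀)
  mass-drop (suc (suc m)) (suc k) o r α _ (s≤s m<k) R≤α α<R = begin
      mass (drop α (idx o (suc k) r))
    ≡⟨ cong (λ β → mass (drop β (idx o (suc k) r))) (sym r₀+α'≡α) ⟩
      mass (drop (r₀ + α') (idx o (suc k) r))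
    ≡⟨ cong (mass ∘ drop (r₀ + α')) (idx-suc o k r) ⟩
      mass (drop (r₀ + α') (replicate r₀ o ++ idx (suc o) k r'))
    ≡⟨ cong mass (drop-replicate-++-+ r₀ α' o (idx (suc o) k r')) ⟩
      mass (drop α' (idx (suc o) k r'))
    ≡⟨ mass-drop (suc m) k (suc o) r' α' (s≤s z≤n) m<k R'≤α' α'<R' ⟩
      (Wt (suc o) k r' k ∸ Wt (suc o) k r' (suc m)) + (suc o + suc m) * (R k r' (suc m) ∸ α')
    ≡⟨ cong₂ _+_ (sym (Wt-diff o k r (suc m))) (cong₂ _*_ (sym (ℕₚ.+-suc o (suc m))) (sym R-diff)) ⟩
      (Wt o (suc k) r (suc k) ∸ Wt o (suc k) r (suc (suc m))) + (o + suc (suc m)) * (R (suc k) r (suc (suc m)) ∸ α)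
    ∎
    where
      open ≡-Reasoning
      r₀ = r Fin.zero
      r' = r ∘ Fin.suc
      α' = α ∸ r₀
      r₀+R'≤α : r₀ + R k r' m ≤ α
      r₀+R'≤α = subst (_≤ α) (R-suc k r m) R≤α
      r₀+α'≡α : r₀ + α' ≡ α
      r₀+α'≡α = ℕₚ.m+[n∸m]≡n (ℕₚ.≤-trans (ℕₚ.m≤m+n r₀ _) r₀+R'≤α)
      R'≤α' : R k r' m ≤ α'
      R'≤α' = ℕₚ.+-cancelˡ-≤ r₀ _ _ (subst (r₀ + R k r' m ≤_) (sym r₀+α'≡α) r₀+R'≤α)
      α'<R' : α' < R k r' (suc m)
      α'<R' = ℕₚ.+-cancelˡ-< r₀ _ _ (subst₂ _<_ (sym r₀+α'≡α) (R-suc k r (suc m)) α<R)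
      R-diff : R (suc k) r (suc (suc m)) ∸ α ≡ R k r' (suc m) ∸ α'
      R-diff = trans (cong₂ _∸_ (R-suc k r (suc m)) (sym r₀+α'≡α)) (ℕₚ.[m+n]∸[m+o]≡n∸o r₀ _ _)

  -- With all r_i ≥ 1 the index list starts at o, ends at o+k−1, moves in steps of 0 or 1,
  -- and stays below o+k.  (In the splits on r₀ below, r₀ = 0 is excluded by r₀ ≥ 1.)
  head-idx : ∀ o k r → (∀ i → 1 ≤ r i) → head (idx o (suc k) r) ≡ just o
  head-idx o k r r≥1 with r Fin.zero | r≥1 Fin.zero | idx-suc o k r
  ... | suc n | _ | eq = cong head eq

  linked-replicate-++ : ∀ n o {L} → Linked Step L → Connected Step (just o) (head L) →
                        Linked Step (replicate (suc n) o ++ L)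
  linked-replicate-++ zero o {[]} _ _ = [-]
  linked-replicate-++ zero o {_ ∷ _} lk (just st) = st ∷ lk
  linked-replicate-++ (suc n) o lk c = (ℕₚ.≤-refl , ℕₚ.n≤1+n o) ∷ linked-replicate-++ n o lk c

  idx-starts-after : ∀ o k r → (∀ i → 1 ≤ r i) → Connected Step (just o) (head (idx (suc o) k r))
  idx-starts-after o zero r _ = just-nothing
  idx-starts-after o (suc k) r r≥1 =
    subst (Connected Step (just o)) (sym (head-idx (suc o) k r r≥1)) (just (ℕₚ.n≤1+n o , ℕₚ.≤-refl))

  idx-linked : ∀ o k r → (∀ i → 1 ≤ r i) → Linked Step (idx o k r)
  idx-linked o zero r r≥1 = []
  idx-linked o (suc k) r r≥1 with r Fin.zero | r≥1 Fin.zero | idx-suc o k r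
  ... | suc n | _ | eq = subst (Linked Step) (sym eq)
          (linked-replicate-++ n o (idx-linked (suc o) k (r ∘ Fin.suc) (r≥1 ∘ Fin.suc))
            (idx-starts-after o k (r ∘ Fin.suc) (r≥1 ∘ Fin.suc)))

  idx-last : ∀ o k r → (∀ i → 1 ≤ r i) → ∃[ xs ] idx o (suc k) r ≡ xs ++ [ o + k ]
  idx-last o zero r r≥1 with r Fin.zero | r≥1 Fin.zero | idx-suc o zero r
  ... | suc n | _ | eq = replicate n o ,
      trans eq (trans (++-identityʳ _) (trans (replicate-suc-∷ʳ n o) (cong (λ z → replicate n o ++ [ z ]) (sym (ℕₚ.+-identityʳ o)))))
  idx-last o (suc k) r r≥1 with idx-last (suc o) k (r ∘ Fin.suc) (r≥1 ∘ Fin.suc)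
  ... | xs , eq = replicate (r Fin.zero) o ++ xs ,
      trans (idx-suc o (suc k) r) (trans (cong (replicate (r Fin.zero) o ++_) eq)
        (trans (sym (++-assoc (replicate (r Fin.zero) o) xs _)) (cong (λ z → (replicate (r Fin.zero) o ++ xs) ++ [ z ]) (sym (ℕₚ.+-suc o k)))))

  idx-bound : ∀ o k r {z} → z ∈ idx o k r → z < o + k
  idx-bound o (suc k) r {z} z∈ with ∈-++⁻ (replicate (r Fin.zero) o) (subst (_ ∈_) (idx-suc o k r) z∈)
  ... | inj₁ z∈rep = subst (_< o + suc k) (sym (∈-replicate (r Fin.zero) z∈rep)) (ℕₚ.m<m+n o (s≤s z≤n))
  ... | inj₂ z∈rest = subst (z <_) (sym (ℕₚ.+-suc o k)) (idx-bound (suc o) k (r ∘ Fin.suc) z∈rest)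

open IndexList

-- a extended by 0 beyond its domain, so that it can be evaluated at any natural number;
-- ext a n stands for a_{n+1}.
ext : ∀ {k} → (Fin k → ℤ) → ℕ → ℤ
ext {k} a n with n <? k
... | yes n<k = a (fromℕ< n<k)
... | no _ = 0ℤ

ext-toℕ : ∀ {k} (a : Fin k → ℤ) i → ext a (toℕ i) ≡ a i
ext-toℕ {k} a i with toℕ i <? k
... | yes i<k = cong a (fromℕ<-toℕ i i<k)
... | no i≮k = ⊥-elim (i≮k (toℕ<n i))

ext-increasing : ∀ {k} (a : Fin k → ℤ) → (∀ i j → i Fin.< j → a i <ℤ a j) →
                 ∀ {m n} → m < n → n < k → ext a m <ℤ ext a n
ext-increasing {k} a a-< {m} {n} m<n n<k with m <? k | n <? k
... | yes m<k | yes n<k = a-< (fromℕ< m<k) (fromℕ< n<k) (subst₂ _<_ (sym (toℕ-fromℕ< m<k)) (sym (toℕ-fromℕ< n<k)) m<n)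
... | no m≮k | _ = ⊥-elim (m≮k (ℕₚ.<-trans m<n n<k))
... | _ | no n≮k = ⊥-elim (n≮k n<k)

seqOf-idx : ∀ k r (a : Fin k → ℤ) → seqOf k r a ≡ map (ext a) (idx 0 k r)
seqOf-idx k r a = sym (trans (map-concatMap (ext a) _ (allFin k))
  (concatMap-cong (λ i → trans (map-replicate (ext a) (r i) (toℕ i)) (cong (replicate (r i)) (ext-toℕ a i))) (allFin k)))

seqOf-cong : ∀ k r {a b : Fin k → ℤ} → (∀ i → a i ≡ b i) → seqOf k r a ≡ seqOf k r b
seqOf-cong k r a≡b = concatMap-cong (λ i → cong (replicate (r i)) (a≡b i)) (allFin k)

-- A positive increasing sequence A₀ < A₁ < … < A_{k'} (values beyond k' are never used).
module IncreasingSequence (A : ℕ → ℤ) (k' : ℕ)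
         (A-< : ∀ {m n} → m < n → n ≤ k' → A m <ℤ A n) (A₀>0 : 0ℤ <ℤ A 0) where
  open import Data.Integer using (_+_; _-_; _*_; 1ℤ)

  A-pos : ∀ {n} → n ≤ k' → 0ℤ <ℤ A n
  A-pos {zero} _ = A₀>0
  A-pos {suc n} n<k' = ℤₚ.<-trans A₀>0 (A-< (s≤s z≤n) n<k')

  A-≤ : ∀ {m n} → m ≤ n → n ≤ k' → A m ≤ℤ A n
  A-≤ m≤n n≤k' with ℕₚ.m≤n⇒m<n∨m≡n m≤n
  ... | inj₁ m<n = ℤₚ.<⇒≤ (A-< m<n n≤k')
  ... | inj₂ refl = ℤₚ.≤-refl

  A-reflects-< : ∀ {m n} → m ≤ k' → A m <ℤ A n → m < n
  A-reflects-< {m} {n} m≤k' Am<An with m <? n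
  ... | yes m<n = m<n
  ... | no m≮n = ⊥-elim (ℤₚ.<⇒≱ Am<An (A-≤ (ℕₚ.≮⇒≥ m≮n) m≤k'))

  <-+ʳ : ∀ v {u} → 0ℤ <ℤ u → v <ℤ v + u
  <-+ʳ v 0<u = subst (_<ℤ v + _) (ℤₚ.+-identityʳ v) (ℤₚ.+-monoʳ-< v 0<u)

  ≤-+ˡ : ∀ v {u} → 0ℤ ≤ℤ u → v ≤ℤ u + v
  ≤-+ˡ v {u} 0≤u = subst (_≤ℤ u + v) (ℤₚ.+-identityˡ v) (ℤₚ.+-monoˡ-≤ v 0≤u)

  sumA : List ℕ → ℤ
  sumA L = sumℤ (map A L)

  sumA-++ : ∀ xs ys → sumA (xs ++ ys) ≡ sumA xs + sumA ys
  sumA-++ xs ys = trans (cong sumℤ (map-++ A xs ys)) (sumℤ-++ (map A xs) (map A ys))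

  sumA-nonneg : ∀ {L} → All (_≤ k') L → 0ℤ ≤ℤ sumA L
  sumA-nonneg [] = ℤₚ.≤-refl
  sumA-nonneg (q≤k' ∷ L≤k') = ℤₚ.+-mono-≤ (ℤₚ.<⇒≤ (A-pos q≤k')) (sumA-nonneg L≤k')

  block : ℤ → ℕ → List ℤ
  block c q = map (λ p → c + A p) (downFrom (suc q))

  ∈-block : ∀ c {q y} → y ∈ block c q → ∃[ p ] p ≤ q × y ≡ c + A p
  ∈-block c y∈ with ∈-map⁻ _ y∈
  ... | p , p∈ , y≡ = p , ℕₚ.≤-pred (∈-downFrom⁻ p∈) , y≡

  block-above : ∀ {c q y} → q ≤ k' → y ∈ block c q → c <ℤ y
  block-above {c} q≤k' y∈ with ∈-block c y∈
  ... | p , p≤q , refl = <-+ʳ c (A-pos (ℕₚ.≤-trans p≤q q≤k'))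

  block-decreasing : ∀ c {q} → q ≤ k' → AllPairs (λ x y → y <ℤ x) (block c q)
  block-decreasing c {q} q≤k' = AllPairsₚ.map⁺ (AllPairsₚ.applyDownFrom⁺₁ id (suc q)
    (λ j<i i<1+q → ℤₚ.+-monoʳ-< c (A-< j<i (ℕₚ.≤-trans (ℕₚ.≤-pred i<1+q) q≤k'))))

  -- chain (q ∷ L) lists, in decreasing order, the sums removed by deleting all terms with
  -- indices in L together with one more term of index p ≤ q.
  chain : List ℕ → List ℤ
  chain [] = []
  chain (q ∷ L) = block (sumA L) q ++ chain L

  length-chain : ∀ L → length (chain L) ≡ mass L
  length-chain [] = refl
  length-chain (q ∷ L) = trans (length-++ (block (sumA L) q))
    (cong₂ ℕ._+_ (trans (length-map _ (downFrom (suc q))) (length-downFrom (suc q))) (length-chain L))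

  chain-bounds : ∀ {L y} → All (_≤ k') L → y ∈ chain L → 0ℤ <ℤ y × y ≤ℤ sumA L
  chain-bounds {q ∷ L} (q≤k' ∷ L≤k') y∈ with ∈-++⁻ (block (sumA L) q) y∈
  ... | inj₁ y∈b with ∈-block (sumA L) y∈b
  ...   | p , p≤q , refl =
          ℤₚ.≤-<-trans (sumA-nonneg L≤k') (block-above q≤k' y∈b) ,
          subst (sumA L + A p ≤ℤ_) (ℤₚ.+-comm (sumA L) (A q)) (ℤₚ.+-monoʳ-≤ (sumA L) (A-≤ p≤q q≤k'))
  chain-bounds {q ∷ L} (q≤k' ∷ L≤k') y∈ | inj₂ y∈c with chain-bounds L≤k' y∈c
  ... | 0<y , y≤ = 0<y , ℤₚ.≤-trans y≤ (≤-+ˡ (sumA L) (ℤₚ.<⇒≤ (A-pos q≤k')))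

  chain-decreasing : ∀ {L} → All (_≤ k') L → AllPairs (λ x y → y <ℤ x) (chain L)
  chain-decreasing [] = []
  chain-decreasing {q ∷ L} (q≤k' ∷ L≤k') = AllPairsₚ.++⁺ (block-decreasing (sumA L) q≤k') (chain-decreasing L≤k')
    (All.tabulate (λ x∈ → All.tabulate (λ y∈ →
      ℤₚ.≤-<-trans (proj₂ (chain-bounds L≤k' y∈)) (block-above q≤k' x∈))))

  SmallSum : ℕ → ℤ → Set
  SmallSum q' y = (∃[ p ] p ≤ k' × y ≡ A p) ⊎ (∃[ p ] p ≤ q' × y ≡ A k' + A p)

  -- On the chain over a list ending in q', k', every element below A_{q'} + A_{k'} is small:
  -- the blocks over earlier entries lie above the sum of the last two terms.
  chain-small : ∀ L₀ {q' y} → All (_≤ k') (L₀ ++ q' ∷ k' ∷ []) → y ∈ chain (L₀ ++ q' ∷ k' ∷ []) →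
                y <ℤ A q' + A k' → SmallSum q' y
  chain-small [] {q'} _ y∈ _ with ∈-++⁻ (block (A k' + 0ℤ) q') y∈
  ... | inj₁ y∈₁ with ∈-block (A k' + 0ℤ) y∈₁
  ...   | p , p≤q' , refl = inj₂ (p , p≤q' , cong (_+ A p) (ℤₚ.+-identityʳ (A k')))
  chain-small [] {q'} _ y∈ _ | inj₂ y∈₂ with ∈-++⁻ (block 0ℤ k') y∈₂
  ... | inj₁ y∈₃ with ∈-block 0ℤ y∈₃
  ...   | p , p≤k' , refl = inj₁ (p , p≤k' , ℤₚ.+-identityˡ (A p))
  chain-small [] {q'} _ y∈ _ | inj₂ y∈₂ | inj₂ ()
  chain-small (z ∷ L₀) {q'} (z≤k' ∷ L≤k') y∈ y< with ∈-++⁻ (block (sumA (L₀ ++ q' ∷ k' ∷ [])) z) y∈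
  ... | inj₂ y∈c = chain-small L₀ L≤k' y∈c y<
  ... | inj₁ y∈b = ⊥-elim (ℤₚ.<-asym y< (ℤₚ.≤-<-trans last-two≤ (block-above z≤k' y∈b)))
    where
      last-two≤ : A q' + A k' ≤ℤ sumA (L₀ ++ q' ∷ k' ∷ [])
      last-two≤ = subst₂ _≤ℤ_ (cong (A q' +_) (ℤₚ.+-identityʳ (A k'))) (sym (sumA-++ L₀ (q' ∷ k' ∷ [])))
                    (≤-+ˡ (sumA (q' ∷ k' ∷ [])) (sumA-nonneg (AllP.++⁻ˡ L₀ L≤k')))

  -- If every sum of two distinct terms below A_{q'} + A_{k'} is small, the sequence is the
  -- arithmetic progression A_n = (n+1) A₀.
  module Progression (q' : ℕ) (1≤q' : 1 ≤ q') (q'≤k' : q' ≤ k') (3≤k' : 3 ≤ k')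
           (small : ∀ {p₁ p₂} → p₁ ≢ p₂ → p₁ ≤ k' → p₂ ≤ k' →
                    A p₁ + A p₂ <ℤ A q' + A k' → SmallSum q' (A p₁ + A p₂)) where

    -- For 1 ≤ j < k' the sum A₀ + A_j is a term A_p with p > j (it is too small to be
    -- A_{k'} + A_p); once p ≤ j+1 is known, it is A_{j+1}.
    next-term : ∀ j → 1 ≤ j → suc j ≤ k' → (∀ {p} → p ≤ k' → A p ≡ A 0 + A j → p ≤ suc j) →
                A 0 + A j ≡ A (suc j)
    next-term j 1≤j j<k' p≤1+j
      with small (ℕₚ.<⇒≢ 1≤j) z≤n (ℕₚ.<⇒≤ j<k') (ℤₚ.+-mono-< (A-< 1≤q' q'≤k') (A-< j<k' ℕₚ.≤-refl))
    ... | inj₁ (p , p≤k' , sum≡Ap) =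
          trans sum≡Ap (cong A (ℕₚ.≤-antisym (p≤1+j p≤k' (sym sum≡Ap)) (A-reflects-< (ℕₚ.<⇒≤ j<k') Aj<Ap)))
      where
        Aj<Ap : A j <ℤ A p
        Aj<Ap = subst (A j <ℤ_) (trans (ℤₚ.+-comm (A j) (A 0)) sum≡Ap) (<-+ʳ (A j) A₀>0)
    ... | inj₂ (p , p≤q' , sum≡) = ⊥-elim (ℤₚ.<-irrefl sum≡ (ℤₚ.<-≤-trans sum<Ak'+A₀ Ak'+A₀≤))
      where
        sum<Ak'+A₀ : A 0 + A j <ℤ A k' + A 0
        sum<Ak'+A₀ = subst (A 0 + A j <ℤ_) (ℤₚ.+-comm (A 0) (A k')) (ℤₚ.+-monoʳ-< (A 0) (A-< j<k' ℕₚ.≤-refl))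
        Ak'+A₀≤ : A k' + A 0 ≤ℤ A k' + A p
        Ak'+A₀≤ = ℤₚ.+-monoʳ-≤ (A k') (A-≤ z≤n (ℕₚ.≤-trans p≤q' q'≤k'))

    -- A₀ + A_j = A_{j+1} for 1 ≤ j < k', by downward induction on j (d = k' − j − 1):
    -- the induction hypothesis A₀ + A_{j+1} = A_{j+2} bounds A₀ + A_j below A_{j+2}.
    recurrence : ∀ d j → 1 ≤ j → j ℕ.+ suc d ≡ k' → A 0 + A j ≡ A (suc j)
    recurrence zero j 1≤j j+1≡k' =
      next-term j 1≤j (ℕₚ.≤-reflexive 1+j≡k') (λ p≤k' _ → subst (_ ≤_) (sym 1+j≡k') p≤k')
      where
        1+j≡k' : suc j ≡ k'
        1+j≡k' = trans (ℕₚ.+-comm 1 j) j+1≡k'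
    recurrence (suc d) j 1≤j j+d+2≡k' = next-term j 1≤j (ℕₚ.<-trans (ℕₚ.n<1+n j) j+2≤k')
        (λ p≤k' Ap≡ → ℕₚ.≤-pred (A-reflects-< p≤k' (subst (_<ℤ A (suc (suc j))) (sym Ap≡) below)))
      where
        j+1+d+1≡k' : suc j ℕ.+ suc d ≡ k'
        j+1+d+1≡k' = trans (sym (ℕₚ.+-suc j (suc d))) j+d+2≡k'
        j+2≤k' : suc (suc j) ≤ k'
        j+2≤k' = subst (suc (suc j) ≤_) j+1+d+1≡k' (ℕₚ.m<m+n (suc j) (s≤s z≤n))
        below : A 0 + A j <ℤ A (suc (suc j))
        below = subst (A 0 + A j <ℤ_) (recurrence d (suc j) (s≤s z≤n) j+1+d+1≡k')
                  (ℤₚ.+-monoʳ-< (A 0) (A-< (ℕₚ.n<1+n j) (ℕₚ.<⇒≤ j+2≤k')))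

    recurrence′ : ∀ j → 1 ≤ j → suc j ≤ k' → A 0 + A j ≡ A (suc j)
    recurrence′ j 1≤j j<k' = recurrence (k' ∸ suc j) j 1≤j (trans (ℕₚ.+-suc j (k' ∸ suc j)) (ℕₚ.m+[n∸m]≡n j<k'))

    j₀ : ℕ
    j₀ = k' ∸ 1

    1≤k' : 1 ≤ k'
    1≤k' = ℕₚ.≤-trans (s≤s z≤n) 3≤k'

    1+j₀≡k' : suc j₀ ≡ k'
    1+j₀≡k' = ℕₚ.m+[n∸m]≡n 1≤k'

    j₀<k' : j₀ < k'
    j₀<k' = ℕₚ.≤-reflexive 1+j₀≡k'

    1<j₀ : 1 < j₀
    1<j₀ = ℕₚ.≤-pred (subst (3 ≤_) (sym 1+j₀≡k') 3≤k')

    A₀+Aj₀≡Ak' : A 0 + A j₀ ≡ A k'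
    A₀+Aj₀≡Ak' = trans (recurrence′ j₀ (ℕₚ.<⇒≤ 1<j₀) j₀<k') (cong A 1+j₀≡k')

    -- A₁ = 2A₀: the sum A₁ + A_{j₀} exceeds A₀ + A_{j₀} = A_{k'}, so it is some A_{k'} + A_p;
    -- p ≥ 1 is too large, and p = 0 gives A₁ + A_{j₀} = A_{k'} + A₀ = 2A₀ + A_{j₀}.
    doubling : A 1 ≡ A 0 + A 0
    doubling with small (ℕₚ.<⇒≢ 1<j₀) 1≤k' (ℕₚ.<⇒≤ j₀<k')
                   (ℤₚ.<-≤-trans (ℤₚ.+-monoʳ-< (A 1) (A-< j₀<k' ℕₚ.≤-refl)) (ℤₚ.+-monoˡ-≤ (A k') (A-≤ 1≤q' q'≤k')))
    ... | inj₁ (p , p≤k' , sum≡Ap) = ⊥-elim (ℤₚ.<-irrefl (sym sum≡Ap) (ℤₚ.≤-<-trans (A-≤ p≤k' ℕₚ.≤-refl) Ak'<sum))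
      where
        Ak'<sum : A k' <ℤ A 1 + A j₀
        Ak'<sum = subst (_<ℤ A 1 + A j₀) A₀+Aj₀≡Ak' (ℤₚ.+-monoˡ-< (A j₀) (A-< (s≤s z≤n) 1≤k'))
    ... | inj₂ (suc p , p<q' , sum≡) = ⊥-elim (ℤₚ.<-irrefl sum≡ (ℤₚ.<-≤-trans sum<A₁+Ak' A₁+Ak'≤))
      where
        sum<A₁+Ak' : A 1 + A j₀ <ℤ A 1 + A k'
        sum<A₁+Ak' = ℤₚ.+-monoʳ-< (A 1) (A-< j₀<k' ℕₚ.≤-refl)
        A₁+Ak'≤ : A 1 + A k' ≤ℤ A k' + A (suc p)
        A₁+Ak'≤ = subst (_≤ℤ A k' + A (suc p)) (ℤₚ.+-comm (A k') (A 1))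
                    (ℤₚ.+-monoʳ-≤ (A k') (A-≤ (s≤s z≤n) (ℕₚ.≤-trans p<q' q'≤k')))
    ... | inj₂ (zero , _ , sum≡) = ∙-cancelʳ (A j₀) (A 1) (A 0 + A 0) (begin
        A 1 + A j₀               ≡⟨ sum≡ ⟩
        A k' + A 0               ≡⟨ cong (_+ A 0) (sym A₀+Aj₀≡Ak') ⟩
        (A 0 + A j₀) + A 0       ≡⟨ ℤₚ.+-assoc (A 0) (A j₀) (A 0) ⟩
        A 0 + (A j₀ + A 0)       ≡⟨ cong (A 0 +_) (ℤₚ.+-comm (A j₀) (A 0)) ⟩
        A 0 + (A 0 + A j₀)       ≡⟨ sym (ℤₚ.+-assoc (A 0) (A 0) (A j₀)) ⟩
        (A 0 + A 0) + A j₀       ∎)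
      where open ≡-Reasoning

    arithmetic : ∀ n → n ≤ k' → A n ≡ A 0 * ℤ.+ suc n
    arithmetic zero _ = sym (ℤₚ.*-identityʳ (A 0))
    arithmetic (suc n) n<k' = begin
        A (suc n)                    ≡⟨ step n n<k' ⟩
        A 0 + A n                    ≡⟨ cong (A 0 +_) (arithmetic n (ℕₚ.<⇒≤ n<k')) ⟩
        A 0 + A 0 * ℤ.+ suc n        ≡⟨ cong (_+ A 0 * ℤ.+ suc n) (sym (ℤₚ.*-identityʳ (A 0))) ⟩
        A 0 * 1ℤ + A 0 * ℤ.+ suc n   ≡⟨ sym (ℤₚ.*-distribˡ-+ (A 0) 1ℤ (ℤ.+ suc n)) ⟩
        A 0 * ℤ.+ suc (suc n)        ∎
      where
        open ≡-Reasoning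
        step : ∀ n → suc n ≤ k' → A (suc n) ≡ A 0 + A n
        step zero _ = doubling
        step (suc n) n+1<k' = sym (recurrence′ (suc n) (s≤s z≤n) n+1<k')

module Extremal (k' : ℕ) (r : Fin (suc k') → ℕ) (r≥1 : ∀ i → 1 ≤ r i)
                (a : Fin (suc k') → ℤ) (a-< : ∀ i j → i Fin.< j → a i <ℤ a j) (a₀>0 : 0ℤ <ℤ a Fin.zero)
                (α : ℕ) (α+2≤N : α ℕ.+ 2 ≤ R (suc k') r (suc k')) where
  open import Data.Integer using (_+_; _-_)

  P : List ℕ
  P = idx 0 (suc k') r

  A : ℕ → ℤ
  A = ext a

  A₀>0 : 0ℤ <ℤ A 0
  A₀>0 = subst (0ℤ <ℤ_) (sym (ext-toℕ a Fin.zero)) a₀>0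

  open IncreasingSequence A k' (λ m<n n≤k' → ext-increasing a a-< m<n (s≤s n≤k')) A₀>0

  S : ℤ
  S = sumA P

  P-linked : Linked Step P
  P-linked = idx-linked 0 (suc k') r r≥1

  P-bound : All (_≤ k') P
  P-bound = All.tabulate (λ z∈ → ℕₚ.≤-pred (idx-bound 0 (suc k') r z∈))

  α≤|P| : α ≤ length P
  α≤|P| = ℕₚ.≤-trans (ℕₚ.m≤m+n α 2) (subst (α ℕ.+ 2 ≤_) (sym (length-idx 0 (suc k') r)) α+2≤N)

  P-all : ∀ {p} → p ≤ k' → p ∈ P
  P-all p≤k' with idx-last 0 k' r r≥1
  ... | X , P≡ = subst (_ ∈_) (sym P≡)
                   (downClosed₀ X (subst (Linked Step) P≡ P-linked) (trans (cong head (sym P≡)) (head-idx 0 k' r r≥1)) p≤k')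

  Keeps : List ℕ → ℤ → Set
  Keeps B e = B ⊆ P × sumA B + e ≡ S

  -- e is removable when at least α terms can be kept: then S − e ∈ Σ_α.
  Removable : ℤ → Set
  Removable e = ∃[ B ] α ≤ length B × Keeps B e

  keeps-all : Keeps P 0ℤ
  keeps-all = ⊆-refl , ℤₚ.+-identityʳ S

  keeps-prefix : ∀ B L → P ≡ B ++ L → Keeps B (sumA L)
  keeps-prefix B L P≡ = subst (B ⊆_) (sym P≡) (++ʳ L ⊆-refl) , trans (sym (sumA-++ B L)) (cong sumA (sym P≡))

  keeps-─ : ∀ {B e x} → Keeps B e → (x∈ : x ∈ B) → Keeps (B ─ x∈) (e + A x)
  keeps-─ {B} {e} {x} (B⊆P , sum≡) x∈ = ⊆-trans (─-⊆ x∈) B⊆P , (begin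
      sumA (B ─ x∈) + (e + A x)    ≡⟨ cong (sumA (B ─ x∈) +_) (ℤₚ.+-comm e (A x)) ⟩
      sumA (B ─ x∈) + (A x + e)    ≡⟨ sym (ℤₚ.+-assoc (sumA (B ─ x∈)) (A x) e) ⟩
      (sumA (B ─ x∈) + A x) + e    ≡⟨ cong (_+ e) (sumℤ-─ A x∈) ⟩
      sumA B + e                   ≡⟨ sum≡ ⟩
      S                            ∎)
    where open ≡-Reasoning

  removable⇒∈Σ : ∀ {e} → Removable e → S - e ∈ Sigma (suc k') r a α
  removable⇒∈Σ {e} (B , α≤|B| , B⊆P , sum≡) =
    subst (_∈ Sigma (suc k') r a α) (x≈z//y (sumA B) e S sum≡)
      (∈-deduplicate⁺ ℤ._≟_ (∈-map⁺ sumℤ (∈-filter⁺ (λ C → α ≤? length C) (⊆⇒∈subseqs kept⊆) α≤|kept|)))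
    where
      kept⊆ : map A B ⊆ seqOf (suc k') r a
      kept⊆ = subst (map A B ⊆_) (sym (seqOf-idx (suc k') r a)) (Sublistₚ.map⁺ A B⊆P)
      α≤|kept| : α ≤ length (map A B)
      α≤|kept| = subst (α ≤_) (sym (length-map A B)) α≤|B|

  -- A sum of two terms with distinct indices is removable, since α ≤ N − 2.
  pair-removable : ∀ {p₁ p₂} → p₁ ≢ p₂ → p₁ ≤ k' → p₂ ≤ k' → Removable (A p₁ + A p₂)
  pair-removable {p₁} {p₂} p₁≢p₂ p₁≤k' p₂≤k' =
    B , α≤|B| , subst (Keeps B) removed≡ (keeps-─ (keeps-─ keeps-all p₂∈) p₁∈)
    where
      p₂∈ : p₂ ∈ P
      p₂∈ = P-all p₂≤k'
      p₁∈ : p₁ ∈ (P ─ p₂∈)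
      p₁∈ = ∈-─ p₂∈ (P-all p₁≤k') p₁≢p₂
      B : List ℕ
      B = (P ─ p₂∈) ─ p₁∈
      removed≡ : (0ℤ + A p₂) + A p₁ ≡ A p₁ + A p₂
      removed≡ = trans (cong (_+ A p₁) (ℤₚ.+-identityˡ (A p₂))) (ℤₚ.+-comm (A p₂) (A p₁))
      N≡|B|+2 : R (suc k') r (suc k') ≡ suc (suc (length B))
      N≡|B|+2 = trans (sym (length-idx 0 (suc k') r))
                  (trans (length-removeAt′ P (index p₂∈)) (cong suc (length-removeAt′ (P ─ p₂∈) (index p₁∈))))
      α≤|B| : α ≤ length B
      α≤|B| = ℕₚ.≤-pred (ℕₚ.≤-pred (subst₂ _≤_ (ℕₚ.+-comm α 2) N≡|B|+2 α+2≤N))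

  -- The tail of P after its first α entries; the chain over it has the size of the bound.
  tailP : List ℕ
  tailP = drop α P

  tailP-bound : All (_≤ k') tailP
  tailP-bound = AllP.drop⁺ α P-bound

  EC : List ℤ
  EC = chain tailP ++ [ 0ℤ ]

  length-EC : length EC ≡ mass tailP ℕ.+ 1
  length-EC = trans (length-++ (chain tailP)) (cong (ℕ._+ 1) (length-chain tailP))

  EC-unique : Unique EC
  EC-unique = AllPairs.map (λ y<x x≡y → ℤₚ.<-irrefl (sym x≡y) y<x)
    (AllPairsₚ.++⁺ (chain-decreasing tailP-bound) ([] ∷ [])
      (All.tabulate (λ y∈ → proj₁ (chain-bounds tailP-bound y∈) ∷ [])))

  -- The elements of chain L are removable when L is a tail of P after at least α entries:
  -- keep the entries before L except one of index p ≤ q (it occurs there as P is a step list).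
  chain-removable : ∀ pre L → P ≡ pre ++ L → α ≤ length pre → ∀ {y} → y ∈ chain L → Removable y
  chain-removable pre (q ∷ L) P≡ α≤|pre| y∈ with ∈-++⁻ (block (sumA L) q) y∈
  ... | inj₂ y∈L = chain-removable (pre ++ [ q ]) L (trans P≡ (sym (++-assoc pre [ q ] L)))
                     (ℕₚ.≤-trans α≤|pre| (subst (length pre ≤_) (sym (length-++ pre)) (ℕₚ.m≤m+n (length pre) 1))) y∈L
  ... | inj₁ y∈b with ∈-block (sumA L) y∈b
  ...   | p , p≤q , refl = ((pre ++ [ q ]) ─ p∈) , α≤|kept| ,
                           keeps-─ (keeps-prefix (pre ++ [ q ]) L (trans P≡ (sym (++-assoc pre [ q ] L)))) p∈
    where
      p∈ : p ∈ pre ++ [ q ]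
      p∈ = downClosed₀ pre (subst (Linked Step) P≡ P-linked) (trans (cong head (sym P≡)) (head-idx 0 k' r r≥1)) p≤q
      α≤|kept| : α ≤ length ((pre ++ [ q ]) ─ p∈)
      α≤|kept| = subst (α ≤_) (ℕₚ.suc-injective (trans (trans (ℕₚ.+-comm 1 (length pre)) (sym (length-++ pre)))
                                                    (length-removeAt′ (pre ++ [ q ]) (index p∈)))) α≤|pre|

  EC-removable : ∀ {y} → y ∈ EC → Removable y
  EC-removable y∈ with ∈-++⁻ (chain tailP) y∈
  ... | inj₁ y∈chain = chain-removable (take α P) tailP (sym (take++drop≡id α P))
                         (ℕₚ.≤-reflexive (sym (trans (length-take α P) (ℕₚ.m≤n⇒m⊓n≡m α≤|P|)))) y∈chain
  ... | inj₂ (here refl) = P , α≤|P| , keeps-all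

  -- Extremality: if |Σ_α| equals the length of the chain, every removable sum is on it, since
  -- e ↦ S − e maps the removable sums injectively into Σ_α.
  onChain : cardSigma (suc k') r a α ≡ length EC → ∀ {e} → Removable e → e ∈ EC
  onChain card {e} rem with e ∈? EC
  ... | yes e∈ = e∈
  ... | no e∉ = ⊥-elim (ℕₚ.<-irrefl (sym card) (subst (_≤ cardSigma (suc k') r a α) (length-map (S -_) (e ∷ EC))
                  (unique⇒length≤ (Uniqueₚ.map⁺ S-injective (AllP.¬Any⇒All¬ EC e∉ ∷ EC-unique))
                    (AllP.map⁺ (removable⇒∈Σ rem ∷ All.tabulate (removable⇒∈Σ ∘ EC-removable))))))
    where
      S-injective : ∀ {x y} → S - x ≡ S - y → x ≡ y
      S-injective {x} {y} eq = ℤₚ.neg-injective (∙-cancelˡ S (ℤ.- x) (ℤ.- y) eq)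

  tail-end : ∃[ L₀ ] ∃[ q' ] tailP ≡ L₀ ++ q' ∷ k' ∷ [] × k' ≤ suc q'
  tail-end with splitLastTwo tailP 2≤|tailP| | idx-last 0 k' r r≥1
    where
      2≤|tailP| : 2 ≤ length tailP
      2≤|tailP| = subst₂ _≤_ (ℕₚ.m+n∸m≡n α 2) (sym (trans (length-drop α P) (cong (_∸ α) (length-idx 0 (suc k') r))))
                    (ℕₚ.∸-monoˡ-≤ α α+2≤N)
  ... | L₀ , u , v , tail≡ | X , P≡X++k' = L₀ , u , subst (λ w → tailP ≡ L₀ ++ u ∷ w ∷ []) v≡k' tail≡ ,
                                            subst (_≤ suc u) v≡k' (lastStep (take α P ++ L₀) (subst (Linked Step) P≡ P-linked))
    where
      P≡ : P ≡ (take α P ++ L₀) ++ u ∷ v ∷ []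
      P≡ = trans (sym (take++drop≡id α P)) (trans (cong (take α P ++_) tail≡) (sym (++-assoc (take α P) L₀ _)))
      v≡k' : v ≡ k'
      v≡k' = proj₂ (∷ʳ-injective ((take α P ++ L₀) ++ [ u ]) X
               (trans (++-assoc (take α P ++ L₀) [ u ] [ v ]) (trans (sym P≡) P≡X++k')))

  extremal⇒arithmetic : 3 ≤ k' → cardSigma (suc k') r a α ≡ length EC →
                        ∀ i → a i ≡ a Fin.zero ℤ.* ℤ.+ suc (toℕ i)
  extremal⇒arithmetic 3≤k' card i with tail-end
  ... | L₀ , q' , tail≡ , k'≤1+q' = begin
      a i                               ≡⟨ sym (ext-toℕ a i) ⟩
      A (toℕ i)                         ≡⟨ arithmetic (toℕ i) (ℕₚ.≤-pred (toℕ<n i)) ⟩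
      A 0 ℤ.* ℤ.+ suc (toℕ i)           ≡⟨ cong (ℤ._* ℤ.+ suc (toℕ i)) (ext-toℕ a Fin.zero) ⟩
      a Fin.zero ℤ.* ℤ.+ suc (toℕ i)    ∎
    where
      open ≡-Reasoning
      1≤q' : 1 ≤ q'
      1≤q' = ℕₚ.≤-pred (ℕₚ.≤-trans (ℕₚ.≤-trans (s≤s (s≤s z≤n)) 3≤k') k'≤1+q')
      q'≤k' : q' ≤ k'
      q'≤k' = All.lookup (subst (All (_≤ k')) tail≡ tailP-bound) (∈-++⁺ʳ L₀ (here refl))
      -- a pair sum below A_{q'} + A_{k'} is on the chain and positive, hence small
      small : ∀ {p₁ p₂} → p₁ ≢ p₂ → p₁ ≤ k' → p₂ ≤ k' → A p₁ + A p₂ <ℤ A q' + A k' → SmallSum q' (A p₁ + A p₂)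
      small p₁≢p₂ p₁≤k' p₂≤k' sum< with ∈-++⁻ (chain tailP) (onChain card (pair-removable p₁≢p₂ p₁≤k' p₂≤k'))
      ... | inj₁ sum∈chain = chain-small L₀ (subst (All (_≤ k')) tail≡ tailP-bound)
                               (subst (λ L → _ ∈ chain L) tail≡ sum∈chain) sum<
      ... | inj₂ (here sum≡0) = ⊥-elim (ℤₚ.<-irrefl (sym sum≡0) (ℤₚ.+-mono-< (A-pos p₁≤k') (A-pos p₂≤k')))
      open Progression q' 1≤q' q'≤k' 3≤k' small

open import Data.Nat using (_+_)
open import Data.Integer using (+_)

-- Theorem 3.5.  Write k = k'+1.  By the counting formula the hypothesis says that |Σ_α| is the
-- length of the chain EC; hence a_i = (i+1) a₁ for all i.
theorem3p5 : (k : ℕ) → (k≥4 : 4 ≤ k) → (r : Fin k → ℕ) → (∀ i → 1 ≤ r i) →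
    (α : ℕ) → α + 2 ≤ R k r k →
    (m : ℕ) → 1 ≤ m → m ≤ k → R k r (m ∸ 1) ≤ α → α < R k r m →
    (a : Fin k → ℤ) → ℤ.+ 0 ℤ.< a (first k≥4) → (∀ i j → i Fin.< j → a i ℤ.< a j) →
    cardSigma k r a α ≡ (W k r k ∸ W k r m) + m ℕ.* (R k r m ∸ α) + 1 →
    seqOf k r a ≡ seqOf k r (λ i → a (first k≥4) ℤ.* + suc (toℕ i))
theorem3p5 (suc k') (s≤s 3≤k') r r≥1 α α+2≤N m 1≤m m≤k R≤α α<R a a₀>0 a-< card =
  seqOf-cong (suc k') r (extremal⇒arithmetic 3≤k' card′)
  where
    open Extremal k' r r≥1 a a-< a₀>0 α α+2≤N
    open ≡-Reasoning
    card′ : cardSigma (suc k') r a α ≡ length EC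
    card′ = begin
      cardSigma (suc k') r a α
        ≡⟨ card ⟩
      (W (suc k') r (suc k') ∸ W (suc k') r m) + m ℕ.* (R (suc k') r m ∸ α) + 1
        ≡⟨ cong (_+ 1) (sym (mass-drop m (suc k') 0 r α 1≤m m≤k R≤α α<R)) ⟩
      mass tailP + 1
        ≡⟨ sym length-EC ⟩
      length EC
        ∎
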